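{- For every positive integer $r$ there is a constant $C_r$ (depending only on $r$) such that for all positive integers $n$, $F_r(n)\ge \frac{n}{r^2+1}-C_r$.
   Context: For a positive integer $n$, $[n]=\{1,\dots,n\}$ and $[n]^{(2)}$ is the set of $2$-element subsets of $[n]$. $\mathcal{C}_{n;r}$ is the set of all maps $c:[n]^{(2)}\to[r]$. For such $c$, a twin of size $\ell$ is a pair of disjoint sets $I=\{i_1<\dots<i_\ell\}$, $J=\{j_1<\dots<j_\ell\}\subset[n]$ with $c(\{i_t,i_{t+1}\})=c(\{j_t,j_{t+1}\})$ for all $t=1,\dots,\ell-1$; $f(c)$ is the maximum size of a twin of $c$, and $F_r(n)=\min_{c\in\mathcal{C}_{n;r}}f(c)$. -}

module Defs where

open import Data.Nat using (ℕ; suc)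
open import Data.Fin using (Fin; toℕ; _<_)
open import Relation.Binary.PropositionalEquality using (_≡_; _≢_)

-- [n] is modelled by Fin n (element k of Fin n stands for k+1), [r] by Fin r.
-- A colouring c : [n]^(2) → [r] is given on 2-subsets {i,j} written with i < j.
Colouring : ℕ → ℕ → Set
Colouring n r = (i j : Fin n) → i < j → Fin r

record IncSeq (n ℓ : ℕ) : Set where
  field
    elt  : Fin ℓ → Fin n
    mono : ∀ (s t : Fin ℓ) → s < t → elt s < elt t

open IncSeq public

Succ : ∀ {ℓ} → Fin ℓ → Fin ℓ → Set
Succ t u = toℕ u ≡ suc (toℕ t)

record Twin {n r : ℕ} (c : Colouring n r) (ℓ : ℕ) : Set where
  field
    I J      : IncSeq n ℓ
    disjoint : ∀ (s t : Fin ℓ) → elt I s ≢ elt J t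
    colours  : ∀ (t u : Fin ℓ) (p : t < u) → Succ t u →
               c (elt I t) (elt I u) (mono I t u p) ≡ c (elt J t) (elt J u) (mono J t u p)

{-# OPTIONS --safe #-}
module Submission where

open import Defs
open import Data.Nat using (ℕ; suc; _+_; _*_; _≤_)
open import Data.Product using (Σ; _×_)

open import Data.Empty using (⊥-elim)
open import Data.Fin as F using (Fin; zero; suc; toℕ; fromℕ<)
import Data.Fin.Properties as F
open import Data.Nat using (zero; _<_; _≤?_; _<?_; z≤n; s≤s; z<s; s≤s⁻¹; s<s⁻¹; NonZero)
open import Data.Nat.DivMod using (_/_; _%_; m≡m%n+[m/n]*n; m%n<n; m/n*n≤m)
open import Data.Nat.Properties
open import Algebra.Properties.CommutativeMonoid.Sum +-0-commutativeMonoid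
  using (sum; sum-remove; sum-cong-≗)
open import Data.Product using (_,_; proj₁; proj₂)
open import Data.Vec.Functional using (Vector; replicate; updateAt; removeAt; _∷_)
open import Data.Vec.Functional.Properties using (updateAt-updates; updateAt-minimal)
open import Function using (const)
open import Relation.Binary.Definitions using (tri<; tri≈; tri>)
open import Relation.Binary.PropositionalEquality
  using (_≡_; _≢_; refl; sym; trans; cong; cong₂; subst; subst₂; module ≡-Reasoning)
open import Relation.Nullary using (yes; no)

-- Cut [0, n) into intervals of length M = r² + 1 and pick in the t-th interval a layer of
-- r + 1 points as follows.  Given layer t, every later point w sees two points of layer t
-- in a common colour (r + 1 points, r colours); as w ranges over the next M points, one such
-- repeated colour α occurs r + 1 times (M > r · r), and those points form layer t + 1.
-- Hence for any two points x, y of layer t + 1 there are distinct a, b in layer t with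
-- c(a, x) = α = c(b, y): x offers two witnesses, so one of them differs from y's witness.
-- Starting from two distinct points of the top layer and descending gives a twin with one
-- point per layer, of size ⌊n / M⌋.

m<n*[1+m/n] : ∀ m n .{{_ : NonZero n}} → m < n * suc (m / n)
m<n*[1+m/n] m n = begin-strict
  m                  ≡⟨ m≡m%n+[m/n]*n m n ⟩
  m % n + m / n * n  <⟨ +-monoˡ-< (m / n * n) (m%n<n m n) ⟩
  n + m / n * n      ≡⟨ *-comm (suc (m / n)) n ⟩
  n * suc (m / n)    ∎
  where open ≤-Reasoning

n≤n*n : ∀ n → n ≤ n * n
n≤n*n zero        = z≤n
n≤n*n n@(suc _) = m≤m*n n n

sum-replicate-* : ∀ k v → sum (replicate k v) ≡ k * v
sum-replicate-* zero    v = refl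
sum-replicate-* (suc k) v = cong (v +_) (sum-replicate-* k v)

sum-updateAt-pred : ∀ {k} (q : Vector ℕ k) β {v} → q β ≡ suc v →
                    sum q ≡ suc (sum (updateAt q β (const v)))
sum-updateAt-pred {suc k} q β {v} qβ≡1+v = begin
  sum q                        ≡⟨ sum-remove q ⟩
  q β + sum (removeAt q β)     ≡⟨ cong₂ _+_ qβ≡1+v (sum-cong-≗ elsewhere) ⟩
  suc v + sum (removeAt q′ β)  ≡⟨ cong (λ x → suc (x + sum (removeAt q′ β))) (updateAt-updates β q) ⟨
  suc (q′ β + sum (removeAt q′ β)) ≡⟨ cong suc (sum-remove q′) ⟨
  suc (sum q′)                 ∎
  where
  open ≡-Reasoning
  q′ = updateAt q β (const v)
  elsewhere : ∀ j → removeAt q β j ≡ removeAt q′ β j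
  elsewhere j = sym (updateAt-minimal (F.punchIn β j) β q (F.punchInᵢ≢i β j))

record Block (lo width m : ℕ) : Set where
  field
    point      : Fin m → ℕ
    point-mono : ∀ {i j} → i F.< j → point i < point j
    lo≤point   : ∀ i → lo ≤ point i
    point<hi   : ∀ i → point i < lo + width

open Block

point-injective : ∀ {lo w m} (B : Block lo w m) {i j} → point B i ≡ point B j → i ≡ j
point-injective B {i} {j} eq with F.<-cmp i j
... | tri< i<j _ _ = ⊥-elim (<⇒≢ (point-mono B i<j) eq)
... | tri≈ _ i≡j _ = i≡j
... | tri> _ _ j<i = ⊥-elim (<⇒≢ (point-mono B j<i) (sym eq))

singletonBlock : ∀ lo w → Block lo (suc w) 1
singletonBlock lo w = record
  { point      = const lo
  ; point-mono = λ { {zero} {zero} () }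
  ; lo≤point   = λ _ → ≤-refl
  ; point<hi   = λ _ → m<m+n lo z<s
  }

widenˡ : ∀ {lo w m} → Block (suc lo) w m → Block lo (suc w) m
widenˡ {lo} {w} B = record
  { point      = point B
  ; point-mono = point-mono B
  ; lo≤point   = λ i → <⇒≤ (lo≤point B i)
  ; point<hi   = λ i → subst (point B i <_) (sym (+-suc lo w)) (point<hi B i)
  }

consˡ : ∀ {lo w m} → Block (suc lo) w m → Block lo (suc w) (suc m)
consˡ {lo} B = record
  { point      = lo ∷ point B
  ; point-mono = increasing
  ; lo≤point   = λ { zero → ≤-refl ; (suc i) → lo≤point (widenˡ B) i }
  ; point<hi   = λ { zero → m<m+n lo z<s ; (suc i) → point<hi (widenˡ B) i }
  }
  where
  increasing : ∀ {i j} → i F.< j → (lo ∷ point B) i < (lo ∷ point B) j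
  increasing {zero}  {suc j} _   = lo≤point B j
  increasing {suc i} {suc j} i<j = point-mono B (s<s⁻¹ i<j)

module _ {k : ℕ} (g : ℕ → Fin k) where

  Monochromatic : ∀ {lo w m} → Fin k → Block lo w m → Set
  Monochromatic α B = ∀ i → g (point B i) ≡ α

  private
    resize : ∀ {lo w m m′ α} → m ≡ m′ →
             Σ (Block lo w m) (Monochromatic α) → Σ (Block lo w m′) (Monochromatic α)
    resize refl B = B

  pigeonholeWithin : ∀ T (q : Vector ℕ k) → sum q ≡ T → ∀ lo →
                     Σ (Fin k) λ α → Σ (Block lo (suc T) (suc (q α))) (Monochromatic α)
  pigeonholeWithin T q Σq≡T lo with q (g lo) in qβ≡
  ... | zero = g lo , resize (cong suc (sym qβ≡)) (singletonBlock lo T , λ _ → refl)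
  pigeonholeWithin zero q Σq≡0 lo | suc v =
    ⊥-elim (0≢1+n (trans (sym Σq≡0) (sum-updateAt-pred q (g lo) qβ≡)))
  pigeonholeWithin (suc T) q Σq≡1+T lo | suc v =
    extend (pigeonholeWithin T q′ Σq′≡T (suc lo))
    where
    β = g lo
    q′ = updateAt q β (const v)
    Σq′≡T : sum q′ ≡ T
    Σq′≡T = suc-injective (trans (sym (sum-updateAt-pred q β qβ≡)) Σq≡1+T)
    extend : (Σ (Fin k) λ α → Σ (Block (suc lo) (suc T) (suc (q′ α))) (Monochromatic α)) →
             Σ (Fin k) λ α → Σ (Block lo (suc (suc T)) (suc (q α))) (Monochromatic α)
    extend (α , B , B≡α) with α F.≟ β
    ... | yes refl = β , resize (cong suc (trans (cong suc (updateAt-updates β q)) (sym qβ≡)))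
                               (consˡ B , λ { zero → refl ; (suc i) → B≡α i })
    ... | no α≢β   = α , resize (cong suc (updateAt-minimal α β q α≢β)) (widenˡ B , B≡α)

  monochromaticBlock : ∀ lo → Σ (Fin k) λ α → Σ (Block lo (suc (k * k)) (suc k)) (Monochromatic α)
  monochromaticBlock = pigeonholeWithin (k * k) (replicate k k) (sum-replicate-* k k)

module Layers {r : ℕ} (κ : ℕ → ℕ → Fin r) where

  M : ℕ
  M = suc (r * r)

  Linked : ∀ {lo w lo′ w′} → Block lo w (suc r) → Block lo′ w′ (suc r) → Set
  Linked B B′ = Σ (Fin r) λ α → ∀ x → Σ (Fin (suc r)) λ a → Σ (Fin (suc r)) λ a′ →
                a ≢ a′ × κ (point B a) (point B′ x) ≡ α × κ (point B a′) (point B′ x) ≡ α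

  collision : ∀ {lo w} (B : Block lo w (suc r)) v →
              Σ (Fin (suc r)) λ a → Σ (Fin (suc r)) λ a′ →
              a F.< a′ × κ (point B a) v ≡ κ (point B a′) v
  collision B v = F.pigeonhole (n<1+n r) (λ a → κ (point B a) v)

  repeatedColour : ∀ {lo w} → Block lo w (suc r) → ℕ → Fin r
  repeatedColour B v = κ (point B (proj₁ (collision B v))) v

  nextBlock : ∀ {lo w} (B : Block lo w (suc r)) lo′ → Σ (Block lo′ M (suc r)) (Linked B)
  nextBlock B lo′ with monochromaticBlock (repeatedColour B) lo′
  ... | α , B′ , B′≡α = B′ , α , linked
    where
    linked : ∀ x → Σ (Fin (suc r)) λ a → Σ (Fin (suc r)) λ a′ →
             a ≢ a′ × κ (point B a) (point B′ x) ≡ α × κ (point B a′) (point B′ x) ≡ α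
    linked x = let (a , a′ , a<a′ , same) = collision B (point B′ x) in
      a , a′ , F.<⇒≢ a<a′ , B′≡α x , trans (sym same) (B′≡α x)

  matchingPair : ∀ {lo w lo′ w′} (B : Block lo w (suc r)) (B′ : Block lo′ w′ (suc r)) →
                 Linked B B′ → ∀ x y → Σ (Fin (suc r)) λ a → Σ (Fin (suc r)) λ b →
                 a ≢ b × κ (point B a) (point B′ x) ≡ κ (point B b) (point B′ y)
  matchingPair B B′ (α , sees) x y with sees x | sees y
  ... | a , a′ , a≢a′ , ax≡α , a′x≡α | b , _ , _ , by≡α , _ with a F.≟ b
  ...   | no a≢b    = a  , b , a≢b , trans ax≡α (sym by≡α)
  ...   | yes refl  = a′ , b , (λ a′≡a → a≢a′ (sym a′≡a)) , trans a′x≡α (sym by≡α)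

  initialLayer : Block 0 M (suc r)
  initialLayer = record
    { point      = toℕ
    ; point-mono = λ i<j → i<j
    ; lo≤point   = λ _ → z≤n
    ; point<hi   = λ i → <-≤-trans (F.toℕ<n i) (s≤s (n≤n*n r))
    }

  abstract
    layer : (t : ℕ) → Block (t * M) M (suc r)
    layer zero    = initialLayer
    layer (suc t) = proj₁ (nextBlock (layer t) (suc t * M))

    layer-linked : ∀ t → Linked (layer t) (layer (suc t))
    layer-linked t = proj₂ (nextBlock (layer t) (suc t * M))

  layer-separated : ∀ {t u} → t < u → ∀ a b → point (layer t) a < point (layer u) b
  layer-separated {t} {u} t<u a b = begin-strict
    point (layer t) a  <⟨ point<hi (layer t) a ⟩
    t * M + M          ≡⟨ +-comm (t * M) M ⟩
    suc t * M          ≤⟨ *-monoˡ-≤ M t<u ⟩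
    u * M              ≤⟨ lo≤point (layer u) b ⟩
    point (layer u) b  ∎
    where open ≤-Reasoning

module _ {P : Set} (R : ℕ → P → P → P → P → Set)
         (descend : ∀ t x y → Σ P λ a → Σ P λ b → a ≢ b × R t a x b y) where

  record Ladder (k : ℕ) (x y : P) : Set where
    field
      left right     : ℕ → P
      left-top       : left k ≡ x
      right-top      : right k ≡ y
      rungs-distinct : ∀ {t} → t ≤ k → left t ≢ right t
      steps          : ∀ {t} → t < k → R t (left t) (left (suc t)) (right t) (right (suc t))

  open Ladder

  placeAbove : ℕ → (ℕ → P) → P → ℕ → P
  placeAbove k f z t with t ≤? k
  ... | yes _ = f t
  ... | no  _ = z

  placeAbove-top : ∀ k f z → placeAbove k f z (suc k) ≡ z
  placeAbove-top k f z with suc k ≤? k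
  ... | yes 1+k≤k = ⊥-elim (n≮n k 1+k≤k)
  ... | no  _     = refl

  extendLadder : ∀ {k a b x y} → Ladder k a b → R k a x b y → x ≢ y → Ladder (suc k) x y
  extendLadder {k} {x = x} {y = y} L step x≢y = record
    { left           = placeAbove k (left L) x
    ; right          = placeAbove k (right L) y
    ; left-top       = placeAbove-top k (left L) x
    ; right-top      = placeAbove-top k (right L) y
    ; rungs-distinct = distinct
    ; steps          = steps′
    }
    where
    distinct : ∀ {t} → t ≤ suc k → placeAbove k (left L) x t ≢ placeAbove k (right L) y t
    distinct {t} _ with t ≤? k
    ... | yes t≤k = rungs-distinct L t≤k
    ... | no  _   = x≢y

    steps′ : ∀ {t} → t < suc k →
             R t (placeAbove k (left L) x t) (placeAbove k (left L) x (suc t))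
                 (placeAbove k (right L) y t) (placeAbove k (right L) y (suc t))
    steps′ {t} t<1+k with t ≤? k | suc t ≤? k
    ... | no t≰k  | _         = ⊥-elim (t≰k (s≤s⁻¹ t<1+k))
    ... | yes _   | yes t<k   = steps L t<k
    ... | yes t≤k | no t≮k with ≤-antisym t≤k (≮⇒≥ t≮k)
    ...   | refl rewrite left-top L | right-top L = step

  ladder : ∀ k {x y} → x ≢ y → Ladder k x y
  ladder zero {x} {y} x≢y = record
    { left = const x ; right = const y ; left-top = refl ; right-top = refl
    ; rungs-distinct = λ _ → x≢y ; steps = λ () }
  ladder (suc k) {x} {y} x≢y with descend k x y
  ... | a , b , a≢b , step = extendLadder (ladder k a≢b) step x≢y

module _ {n r : ℕ} (c : Colouring n r) (junk : Fin r) where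

  -- Off the pairs a < b < n the value is junk; only such pairs are ever coloured.
  colourℕ : ℕ → ℕ → Fin r
  colourℕ a b with a <? b | b <? n
  ... | yes a<b | yes b<n = c (fromℕ< (<-trans a<b b<n)) (fromℕ< b<n)
                              (subst₂ _<_ (sym (F.toℕ-fromℕ< _)) (sym (F.toℕ-fromℕ< _)) a<b)
  ... | _       | _       = junk

  c-cong : ∀ {i i′ j j′ : Fin n} {i<j : i F.< j} {i′<j′ : i′ F.< j′} →
           i ≡ i′ → j ≡ j′ → c i j i<j ≡ c i′ j′ i′<j′
  c-cong {i<j = i<j} {i′<j′} refl refl = cong (c _ _) (<-irrelevant i<j i′<j′)

  colourℕ-toℕ : ∀ i j (i<j : i F.< j) → colourℕ (toℕ i) (toℕ j) ≡ c i j i<j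
  colourℕ-toℕ i j i<j with toℕ i <? toℕ j | toℕ j <? n
  ... | yes i<j′ | yes j<n = c-cong (F.fromℕ<-toℕ i _) (F.fromℕ<-toℕ j j<n)
  ... | no i≮j   | _       = ⊥-elim (i≮j i<j)
  ... | yes _    | no j≮n  = ⊥-elim (j≮n (F.toℕ<n j))

  toIncSeq : ∀ ℓ (f : ℕ → ℕ) → (∀ {s t} → s < t → f s < f t) → (∀ {t} → t < ℓ → f t < n) →
             IncSeq n ℓ
  toIncSeq ℓ f f-mono f<n = record
    { elt  = λ t → fromℕ< (f<n (F.toℕ<n t))
    ; mono = λ s t s<t → subst₂ _<_ (sym (F.toℕ-fromℕ< _)) (sym (F.toℕ-fromℕ< _)) (f-mono s<t)
    }

  twinOfSequences : ∀ ℓ (f g : ℕ → ℕ) →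
                    (f-mono : ∀ {s t} → s < t → f s < f t) → (g-mono : ∀ {s t} → s < t → g s < g t) →
                    (f<n : ∀ {t} → t < ℓ → f t < n) → (g<n : ∀ {t} → t < ℓ → g t < n) →
                    (∀ {s t} → s < ℓ → t < ℓ → f s ≢ g t) →
                    (∀ {t} → suc t < ℓ → colourℕ (f t) (f (suc t)) ≡ colourℕ (g t) (g (suc t))) →
                    Twin c ℓ
  twinOfSequences ℓ f g f-mono g-mono f<n g<n f≢g same = record
    { I        = I
    ; J        = J
    ; disjoint = λ s t I≡J → f≢g (F.toℕ<n s) (F.toℕ<n t)
                   (trans (sym (toℕ-I s)) (trans (cong toℕ I≡J) (toℕ-J t)))
    ; colours  = colours
    }
    where
    I = toIncSeq ℓ f f-mono f<n
    J = toIncSeq ℓ g g-mono g<n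
    toℕ-I : ∀ t → toℕ (elt I t) ≡ f (toℕ t)
    toℕ-I t = F.toℕ-fromℕ< _
    toℕ-J : ∀ t → toℕ (elt J t) ≡ g (toℕ t)
    toℕ-J t = F.toℕ-fromℕ< _
    colours : ∀ t u (t<u : t F.< u) → Succ t u →
              c (elt I t) (elt I u) (mono I t u t<u) ≡ c (elt J t) (elt J u) (mono J t u t<u)
    colours t u t<u u≡1+t = begin
      c (elt I t) (elt I u) _                ≡⟨ colourℕ-toℕ (elt I t) (elt I u) (mono I t u t<u) ⟨
      colourℕ (toℕ (elt I t)) (toℕ (elt I u)) ≡⟨ cong₂ colourℕ (toℕ-I t) (toℕ-I u) ⟩
      colourℕ (f (toℕ t)) (f (toℕ u))         ≡⟨ cong (λ v → colourℕ (f (toℕ t)) (f v)) u≡1+t ⟩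
      colourℕ (f (toℕ t)) (f (suc (toℕ t)))   ≡⟨ same (subst (_< ℓ) u≡1+t (F.toℕ<n u)) ⟩
      colourℕ (g (toℕ t)) (g (suc (toℕ t)))   ≡⟨ cong (λ v → colourℕ (g (toℕ t)) (g v)) u≡1+t ⟨
      colourℕ (g (toℕ t)) (g (toℕ u))         ≡⟨ cong₂ colourℕ (toℕ-J t) (toℕ-J u) ⟨
      colourℕ (toℕ (elt J t)) (toℕ (elt J u)) ≡⟨ colourℕ-toℕ (elt J t) (elt J u) (mono J t u t<u) ⟩
      c (elt J t) (elt J u) _                ∎
      where open ≡-Reasoning

emptyTwin : ∀ {n r} (c : Colouring n r) → Twin c 0
emptyTwin c = record
  { I = record { elt = λ () ; mono = λ () }
  ; J = record { elt = λ () ; mono = λ () }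
  ; disjoint = λ () ; colours = λ () }

module Construction {n r : ℕ} (c : Colouring n (suc r)) where

  open Layers (colourℕ c zero) public

  SameStep : ℕ → Fin (suc (suc r)) → Fin (suc (suc r)) → Fin (suc (suc r)) → Fin (suc (suc r)) → Set
  SameStep t a x b y = colourℕ c zero (point (layer t) a) (point (layer (suc t)) x)
                     ≡ colourℕ c zero (point (layer t) b) (point (layer (suc t)) y)

  matchingStep : ∀ t x y → Σ (Fin (suc (suc r))) λ a → Σ (Fin (suc (suc r))) λ b →
                 a ≢ b × SameStep t a x b y
  matchingStep t = matchingPair (layer t) (layer (suc t)) (layer-linked t)

  twin : ∀ ℓ → ℓ * M ≤ n → Twin c ℓ
  twin zero    _      = emptyTwin c
  twin (suc k) ℓM≤n = twinOfSequences c zero (suc k) f g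
    (λ s<t → layer-separated s<t _ _) (λ s<t → layer-separated s<t _ _)
    (λ {t} → below (left L t)) (λ {t} → below (right L t)) disjoint (λ 1+t<ℓ → steps L (s<s⁻¹ 1+t<ℓ))
    where
    open Ladder
    L : Ladder SameStep matchingStep k zero (suc zero)
    L = ladder SameStep matchingStep k (λ ())
    f g : ℕ → ℕ
    f t = point (layer t) (left L t)
    g t = point (layer t) (right L t)
    below : ∀ {t} a → t < suc k → point (layer t) a < n
    below {t} a t<ℓ = <-≤-trans (point<hi (layer t) a)
                        (≤-trans (≤-reflexive (+-comm (t * M) M)) (≤-trans (*-monoˡ-≤ M t<ℓ) ℓM≤n))
    disjoint : ∀ {s t} → s < suc k → t < suc k → f s ≢ g t
    disjoint {s} {t} _ t<ℓ fs≡gt with <-cmp s t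
    ... | tri< s<t _ _ = <⇒≢ (layer-separated s<t _ _) fs≡gt
    ... | tri> _ _ t<s = <⇒≢ (layer-separated t<s _ _) (sym fs≡gt)
    ... | tri≈ _ refl _ = rungs-distinct L (s≤s⁻¹ t<ℓ) (point-injective (layer t) fs≡gt)

theorem1 : (r : ℕ) → 1 ≤ r → Σ ℕ λ C → (n : ℕ) → 1 ≤ n → (c : Colouring n r) →
    Σ ℕ λ ℓ → Twin c ℓ × (n ≤ (r * r + 1) * (ℓ + C))
theorem1 zero    ()
theorem1 (suc r) _ = 1 , λ n _ c → let open Construction c in
  n / M , twin (n / M) (m/n*n≤m n M) ,
  subst₂ (λ a b → n ≤ a * b) (+-comm 1 (suc r * suc r)) (+-comm 1 (n / M)) (<⇒≤ (m<n*[1+m/n] n M))
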